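{- Let $p$ be a prime and $g$ an integer with $\gcd(g,p)=1$. Let $n$ be the least positive integer such that $g^n \equiv 1 \pmod p$, and suppose $n \not\equiv 2 \pmod 4$. Let $a \ge 0$ be an integer and let $h$ be an integer with $h \equiv g^a \pmod p$. Then $Q(g,h^2,p)$ is invertible modulo $p$ and \[ g^{a^2} \equiv Q(g,1,p)\,\bigl(Q(g,h^2,p)\bigr)^{ -1} \pmod p. \]
   Context: For a prime $p$ and integers $g,h$, the quadratic sum is defined as $Q(g,h,p) = \sum_{k=1}^{p-1} g^{k^2} h^k \pmod p$. -}

module Defs where

open import Data.Nat as ℕ using (ℕ; zero; suc)
open import Data.Integer using (ℤ; +_; _+_; _-_; _*_; _^_; 0ℤ; 1ℤ)
open import Data.Integer.Divisibility using (_∣_)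
open import Data.Product using (_×_)
open import Relation.Nullary using (¬_)

infix 4 _≡_[mod_]
_≡_[mod_] : ℤ → ℤ → ℕ → Set
a ≡ b [mod p ] = (+ p) ∣ (a - b)

sumTo : ℕ → (ℕ → ℤ) → ℤ
sumTo zero    f = 0ℤ
sumTo (suc m) f = sumTo m f + f (suc m)

sumFrom1 : ℕ → (ℕ → ℤ) → ℤ
sumFrom1 p f = sumTo (p ℕ.∸ 1) f

Q : ℤ → ℤ → ℕ → ℤ
Q g h p = sumFrom1 p (λ k → (g ^ (k ℕ.* k)) * (h ^ k))

IsMultOrder : ℤ → ℕ → ℕ → Set
IsMultOrder g p n =
  (0 ℕ.< n) × ((g ^ n) ≡ 1ℤ [mod p ]) ×
  (∀ m → 0 ℕ.< m → m ℕ.< n → ¬ ((g ^ m) ≡ 1ℤ [mod p ]))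

{-# OPTIONS --safe #-}
-- Put T(a) = Σ_{k=1}^{p-1} g^{(k+a)²}. By Fermat (derived from (x + y)^p ≡ x^p + y^p) exponents of
-- g only matter modulo p - 1, so shifting k ↦ k + 1 permutes the terms of T(a) and T(a) ≡ T(0) =
-- Q(g,1,p); expanding (k+a)² shows Q(g,h²,p)·g^{a²} ≡ T(a) when h ≡ g^a. It remains to see that
-- Q(g,1,p) is a unit. Multiplying it by Σ_j g^{-j²} and using the shift invariance once more gives
-- Σ_k g^{k²} Σ_j g^{2kj}. The inner geometric sum is p - 1 if g^{2k} ≡ 1 and 0 otherwise; in the
-- first case n ∣ 2k, hence n ∣ k² because n ≢ 2 (mod 4), so g^{k²} ≡ 1. The product is thus
-- (p - 1)·#{k ≤ p - 1 : g^{2k} ≡ 1}, a product of two integers in [1, p - 1].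
module Submission where

open import Defs
open import Data.Nat using (ℕ; _%_)
import Data.Nat
open import Data.Nat.Primality using (Prime)
open import Data.Integer using (ℤ; +_; _*_; _^_; 1ℤ)
open import Data.Integer.GCD using (gcd)
open import Data.Product using (_×_; ∃)
open import Relation.Binary.PropositionalEquality using (_≡_; _≢_)

open import Algebra.Bundles using (CommutativeRing)
open import Data.Fin.Base as Fin using (toℕ; inject₁; fromℕ)
open import Data.Fin.Patterns using (0F)
open import Data.Fin.Properties using (toℕ-inject₁; toℕ-fromℕ; toℕ<n)
open import Data.Integer as ℤ using (-[1+_]; 0ℤ; _+_; _-_; -_; ∣_∣)
import Data.Integer.Properties as ℤ
open import Data.Integer.Divisibility.Signed using (∣ᵤ⇒∣; ∣⇒∣ᵤ) renaming (_∣_ to _∣ℤ_)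
import Data.Integer.Divisibility.Signed as ℤ
open import Data.Integer.Tactic.RingSolver using (solve-∀)
open import Data.Nat as ℕ using (zero; suc; z≤n; s≤s; _∸_; _/_)
open import Data.Nat.Combinatorics using (_C_; nCn≡1; nC1≡n; nCk+nC[k+1]≡[n+1]C[k+1])
open import Data.Nat.Combinatorics.Specification using (k>n⇒nCk≡0)
import Data.Nat.Divisibility as ℕ
import Data.Nat.DivMod as ℕ
import Data.Nat.GCD as ℕ
open import Data.Nat.Primality using (euclidsLemma; prime⇒nonTrivial; prime⇒nonZero)
import Data.Nat.Properties as ℕ
import Data.Nat.Tactic.RingSolver as ℕ
open import Data.Product using (_,_)
open import Data.Sum using (_⊎_; inj₁; inj₂)
open import Function using (_∘_)
open import Level using (0ℓ)
open import Relation.Binary.PropositionalEquality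
  using (refl; sym; trans; cong; cong₂; subst; module ≡-Reasoning)
import Relation.Binary.Reasoning.Setoid
open import Relation.Nullary using (¬_; contradiction; Dec; yes; no)
import Relation.Nullary.Decidable as Dec
open import Relation.Unary using (Decidable)

[1+k]*[1+n]C[1+k]≡[1+n]*nCk : ∀ n k → suc k ℕ.* (suc n C suc k) ≡ suc n ℕ.* (n C k)
[1+k]*[1+n]C[1+k]≡[1+n]*nCk zero    zero    = refl
[1+k]*[1+n]C[1+k]≡[1+n]*nCk zero    (suc k) =
  trans (cong (suc (suc k) ℕ.*_) (k>n⇒nCk≡0 {1} {suc (suc k)} (s≤s (s≤s z≤n)))) (ℕ.*-zeroʳ (suc (suc k)))
[1+k]*[1+n]C[1+k]≡[1+n]*nCk (suc n) zero    =
  trans (ℕ.*-identityˡ _) (trans (nC1≡n (suc (suc n))) (sym (ℕ.*-identityʳ _)))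
[1+k]*[1+n]C[1+k]≡[1+n]*nCk (suc n) (suc k) = begin
  suc (suc k) ℕ.* (suc (suc n) C suc (suc k))
    ≡⟨ cong (suc (suc k) ℕ.*_) (sym (nCk+nC[k+1]≡[n+1]C[k+1] (suc n) (suc k))) ⟩
  suc (suc k) ℕ.* (a ℕ.+ b)
    ≡⟨ rearrange k a b ⟩
  a ℕ.+ (suc k ℕ.* a ℕ.+ suc (suc k) ℕ.* b)
    ≡⟨ cong (a ℕ.+_) (cong₂ ℕ._+_ ([1+k]*[1+n]C[1+k]≡[1+n]*nCk n k)
                                  ([1+k]*[1+n]C[1+k]≡[1+n]*nCk n (suc k))) ⟩
  a ℕ.+ (suc n ℕ.* (n C k) ℕ.+ suc n ℕ.* (n C suc k))
    ≡⟨ cong (a ℕ.+_) (sym (ℕ.*-distribˡ-+ (suc n) (n C k) (n C suc k))) ⟩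
  a ℕ.+ suc n ℕ.* (n C k ℕ.+ n C suc k)
    ≡⟨ cong (λ t → a ℕ.+ suc n ℕ.* t) (nCk+nC[k+1]≡[n+1]C[k+1] n k) ⟩
  suc (suc n) ℕ.* a ∎
  where
  open ≡-Reasoning
  a b : ℕ
  a = suc n C suc k
  b = suc n C suc (suc k)
  rearrange : ∀ k a b → suc (suc k) ℕ.* (a ℕ.+ b) ≡ a ℕ.+ (suc k ℕ.* a ℕ.+ suc (suc k) ℕ.* b)
  rearrange = ℕ.solve-∀

sumTo-*ˡ : ∀ n c f → c * sumTo n f ≡ sumTo n (λ k → c * f k)
sumTo-*ˡ zero    c f = ℤ.*-zeroʳ c
sumTo-*ˡ (suc n) c f =
  trans (ℤ.*-distribˡ-+ c (sumTo n f) (f (suc n))) (cong (_+ c * f (suc n)) (sumTo-*ˡ n c f))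

sumTo-*ʳ : ∀ n c f → sumTo n f * c ≡ sumTo n (λ k → f k * c)
sumTo-*ʳ zero    c f = ℤ.*-zeroˡ c
sumTo-*ʳ (suc n) c f =
  trans (ℤ.*-distribʳ-+ c (sumTo n f) (f (suc n))) (cong (_+ f (suc n) * c) (sumTo-*ʳ n c f))

sumTo-+ : ∀ n f h → sumTo n (λ k → f k + h k) ≡ sumTo n f + sumTo n h
sumTo-+ zero    f h = refl
sumTo-+ (suc n) f h =
  trans (cong (_+ (f (suc n) + h (suc n))) (sumTo-+ n f h))
        (interchange (sumTo n f) (sumTo n h) (f (suc n)) (h (suc n)))
  where
  interchange : ∀ a b c d → a + b + (c + d) ≡ a + c + (b + d)
  interchange = solve-∀

sumTo-zero : ∀ n → sumTo n (λ _ → 0ℤ) ≡ 0ℤ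
sumTo-zero zero    = refl
sumTo-zero (suc n) = cong (_+ 0ℤ) (sumTo-zero n)

sumTo-comm : ∀ a b (F : ℕ → ℕ → ℤ) →
  sumTo a (λ j → sumTo b (F j)) ≡ sumTo b (λ k → sumTo a (λ j → F j k))
sumTo-comm zero    b F = sym (sumTo-zero b)
sumTo-comm (suc a) b F =
  trans (cong (_+ sumTo b (F (suc a))) (sumTo-comm a b F))
        (sym (sumTo-+ b (λ k → sumTo a (λ j → F j k)) (F (suc a))))

sumTo-rotate : ∀ n f → sumTo n (f ∘ suc) + f 1 ≡ sumTo n f + f (suc n)
sumTo-rotate zero    f = refl
sumTo-rotate (suc n) f =
  trans (swap (sumTo n (f ∘ suc)) (f 1) (f (suc (suc n))))
        (cong (_+ f (suc (suc n))) (sumTo-rotate n f))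
  where
  swap : ∀ a b c → a + c + b ≡ a + b + c
  swap = solve-∀

sumTo-const : ∀ n c → sumTo n (λ _ → c) ≡ + n * c
sumTo-const zero    c = sym (ℤ.*-zeroˡ c)
sumTo-const (suc n) c =
  trans (cong (_+ c) (sumTo-const n c)) (trans (ℤ.+-comm (+ n * c) c) (sym (ℤ.suc-* (+ n) c)))

sumTo-geometric : ∀ x n → (x - 1ℤ) * sumTo n (x ^_) ≡ x * x ^ n - x
sumTo-geometric x zero    = lemma x
  where
  lemma : ∀ x → (x - 1ℤ) * 0ℤ ≡ x * 1ℤ - x
  lemma = solve-∀
sumTo-geometric x (suc n) =
  trans (ℤ.*-distribˡ-+ (x - 1ℤ) (sumTo n (x ^_)) (x * x ^ n))
        (trans (cong (_+ (x - 1ℤ) * (x * x ^ n)) (sumTo-geometric x n)) (lemma x (x ^ n)))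
  where
  lemma : ∀ x y → x * y - x + (x - 1ℤ) * (x * y) ≡ x * (x * y) - x
  lemma = solve-∀

count : {P : ℕ → Set} → Decidable P → ℕ → ℕ
count P? zero    = 0
count P? (suc n) with P? (suc n)
... | yes _ = suc (count P? n)
... | no  _ = count P? n

count≤ : ∀ {P : ℕ → Set} (P? : Decidable P) n → count P? n ℕ.≤ n
count≤ P? zero    = z≤n
count≤ P? (suc n) with P? (suc n)
... | yes _ = s≤s (count≤ P? n)
... | no  _ = ℕ.m≤n⇒m≤1+n (count≤ P? n)

count>0 : ∀ {P : ℕ → Set} (P? : Decidable P) {n} → 0 ℕ.< n → P n → 0 ℕ.< count P? n
count>0 P? {suc n} _ Pn with P? (suc n)
... | yes _  = s≤s z≤n
... | no ¬Pn = contradiction Pn ¬Pn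

odd∣2k⇒odd∣k : ∀ {n} t k → n ≡ 1 ℕ.+ 2 ℕ.* t → n ℕ.∣ 2 ℕ.* k → n ℕ.∣ k
odd∣2k⇒odd∣k t k refl n∣2k =
  ℕ.∣m+n∣m⇒∣n (subst (1 ℕ.+ 2 ℕ.* t ℕ.∣_) (split t k) (ℕ.m∣m*n k)) (ℕ.∣n⇒∣m*n t n∣2k)
  where
  split : ∀ t k → (1 ℕ.+ 2 ℕ.* t) ℕ.* k ≡ t ℕ.* (2 ℕ.* k) ℕ.+ k
  split = ℕ.solve-∀

4q∣2k⇒4q∣k*k : ∀ {n} q k → n ≡ q ℕ.* 4 → n ℕ.∣ 2 ℕ.* k → n ℕ.∣ k ℕ.* k
4q∣2k⇒4q∣k*k q k refl n∣2k with ℕ.*-cancelˡ-∣ {q ℕ.* 2} {k} 2 (subst (ℕ._∣ 2 ℕ.* k) (regroup q) n∣2k)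
  where
  regroup : ∀ q → q ℕ.* 4 ≡ 2 ℕ.* (q ℕ.* 2)
  regroup = ℕ.solve-∀
... | ℕ.divides s refl = ℕ.divides (s ℕ.* s ℕ.* q) (square s q)
  where
  square : ∀ s q → s ℕ.* (q ℕ.* 2) ℕ.* (s ℕ.* (q ℕ.* 2)) ≡ s ℕ.* s ℕ.* q ℕ.* (q ℕ.* 4)
  square = ℕ.solve-∀

∣2k⇒∣k*k : ∀ n k → n % 4 ≢ 2 → n ℕ.∣ 2 ℕ.* k → n ℕ.∣ k ℕ.* k
∣2k⇒∣k*k n k n≢2 n∣2k with n % 4 | ℕ.m≡m%n+[m/n]*n n 4 | ℕ.m%n<n n 4
... | 0 | n≡4q | _ = 4q∣2k⇒4q∣k*k (n / 4) k n≡4q n∣2k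
... | 1 | n≡1+4q | _ = ℕ.∣m⇒∣m*n k (odd∣2k⇒odd∣k (n / 4 ℕ.* 2) k (trans n≡1+4q (one (n / 4))) n∣2k)
  where
  one : ∀ q → 1 ℕ.+ q ℕ.* 4 ≡ 1 ℕ.+ 2 ℕ.* (q ℕ.* 2)
  one = ℕ.solve-∀
... | 2 | _ | _ = contradiction refl n≢2
... | 3 | n≡3+4q | _ =
  ℕ.∣m⇒∣m*n k (odd∣2k⇒odd∣k (1 ℕ.+ n / 4 ℕ.* 2) k (trans n≡3+4q (three (n / 4))) n∣2k)
  where
  three : ∀ q → 3 ℕ.+ q ℕ.* 4 ≡ 1 ℕ.+ 2 ℕ.* (1 ℕ.+ q ℕ.* 2)
  three = ℕ.solve-∀
... | suc (suc (suc (suc _))) | _ | s≤s (s≤s (s≤s (s≤s ())))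

^-distribˡ-+-+ : ∀ x i j k → x ^ (i ℕ.+ j ℕ.+ k) ≡ x ^ i * x ^ j * x ^ k
^-distribˡ-+-+ x i j k =
  trans (ℤ.^-distribˡ-+-* x (i ℕ.+ j) k) (cong (_* x ^ k) (ℤ.^-distribˡ-+-* x i j))

module Congruence (d : ℕ) where

  infix 4 _≈_ _≉_ _≈?_

  -- A record rather than a synonym for _≡_[mod_], so that both sides can be inferred from a proof.
  record _≈_ (x y : ℤ) : Set where
    constructor fromMod
    field toMod : x ≡ y [mod d ]
  open _≈_ public

  _≉_ : ℤ → ℤ → Set
  x ≉ y = ¬ x ≈ y

  ≈-via : ∀ {x y} e → x - y ≡ e → + d ∣ℤ e → x ≈ y
  ≈-via e x-y≡e d∣e = fromMod (∣⇒∣ᵤ (subst (+ d ∣ℤ_) (sym x-y≡e) d∣e))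

  ≈⇒∣ : ∀ {x y} → x ≈ y → + d ∣ℤ x - y
  ≈⇒∣ = ∣ᵤ⇒∣ ∘ toMod

  ∣⇒≈ : ∀ {x y} → + d ∣ℤ x - y → x ≈ y
  ∣⇒≈ = ≈-via _ refl

  ∣⇒≈0 : ∀ {x} → + d ∣ℤ x → x ≈ 0ℤ
  ∣⇒≈0 {x} = ≈-via x (ℤ.+-identityʳ x)

  ≈0⇒∣ : ∀ {x} → x ≈ 0ℤ → + d ∣ℤ x
  ≈0⇒∣ {x} x≈0 = subst (+ d ∣ℤ_) (ℤ.+-identityʳ x) (≈⇒∣ x≈0)

  ≡⇒≈ : ∀ {x y} → x ≡ y → x ≈ y
  ≡⇒≈ {x} refl = ≈-via 0ℤ (ℤ.+-inverseʳ x) (ℤ.divides 0ℤ (sym (ℤ.*-zeroˡ (+ d))))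

  ≈-refl : ∀ {x} → x ≈ x
  ≈-refl = ≡⇒≈ refl

  ≈-sym : ∀ {x y} → x ≈ y → y ≈ x
  ≈-sym {x} {y} x≈y = ≈-via (- (x - y)) (lemma x y) (ℤ.∣m⇒∣-m (≈⇒∣ x≈y))
    where
    lemma : ∀ x y → y - x ≡ - (x - y)
    lemma = solve-∀

  ≈-trans : ∀ {x y z} → x ≈ y → y ≈ z → x ≈ z
  ≈-trans {x} {y} {z} x≈y y≈z = ≈-via _ (lemma x y z) (ℤ.∣m∣n⇒∣m+n (≈⇒∣ x≈y) (≈⇒∣ y≈z))
    where
    lemma : ∀ x y z → x - z ≡ (x - y) + (y - z)
    lemma = solve-∀

  +-cong : ∀ {x y z w} → x ≈ y → z ≈ w → x + z ≈ y + w
  +-cong {x} {y} {z} {w} x≈y z≈w = ≈-via _ (lemma x y z w) (ℤ.∣m∣n⇒∣m+n (≈⇒∣ x≈y) (≈⇒∣ z≈w))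
    where
    lemma : ∀ x y z w → (x + z) - (y + w) ≡ (x - y) + (z - w)
    lemma = solve-∀

  *-cong : ∀ {x y z w} → x ≈ y → z ≈ w → x * z ≈ y * w
  *-cong {x} {y} {z} {w} x≈y z≈w =
    ≈-via _ (lemma x y z w) (ℤ.∣m∣n⇒∣m+n (ℤ.∣n⇒∣m*n x (≈⇒∣ z≈w)) (ℤ.∣m⇒∣m*n w (≈⇒∣ x≈y)))
    where
    lemma : ∀ x y z w → x * z - y * w ≡ x * (z - w) + (x - y) * w
    lemma = solve-∀

  -‿cong : ∀ {x y} → x ≈ y → - x ≈ - y
  -‿cong {x} {y} x≈y = ≈-via _ (lemma x y) (ℤ.∣m⇒∣-m (≈⇒∣ x≈y))
    where
    lemma : ∀ x y → - x - - y ≡ - (x - y)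
    lemma = solve-∀

  ℤmod : CommutativeRing 0ℓ 0ℓ
  ℤmod = record
    { Carrier = ℤ ; _≈_ = _≈_ ; _+_ = _+_ ; _*_ = _*_ ; -_ = -_ ; 0# = 0ℤ ; 1# = 1ℤ
    ; isCommutativeRing = record
      { isRing = record
        { +-isAbelianGroup = record
          { isGroup = record
            { isMonoid = record
              { isSemigroup = record
                { isMagma = record
                  { isEquivalence = record { refl = ≈-refl ; sym = ≈-sym ; trans = ≈-trans }
                  ; ∙-cong = +-cong }
                ; assoc = λ x y z → ≡⇒≈ (ℤ.+-assoc x y z) }
              ; identity = (≡⇒≈ ∘ ℤ.+-identityˡ) , (≡⇒≈ ∘ ℤ.+-identityʳ) }
            ; inverse = (≡⇒≈ ∘ ℤ.+-inverseˡ) , (≡⇒≈ ∘ ℤ.+-inverseʳ)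
            ; ⁻¹-cong = -‿cong }
          ; comm = λ x y → ≡⇒≈ (ℤ.+-comm x y) }
        ; *-cong = *-cong
        ; *-assoc = λ x y z → ≡⇒≈ (ℤ.*-assoc x y z)
        ; *-identity = (≡⇒≈ ∘ ℤ.*-identityˡ) , (≡⇒≈ ∘ ℤ.*-identityʳ)
        ; distrib = (λ x y z → ≡⇒≈ (ℤ.*-distribˡ-+ x y z))
                  , (λ x y z → ≡⇒≈ (ℤ.*-distribʳ-+ x y z)) }
      ; *-comm = λ x y → ≡⇒≈ (ℤ.*-comm x y) } }

  module ≈-Reasoning = Relation.Binary.Reasoning.Setoid (CommutativeRing.setoid ℤmod)
  open import Algebra.Properties.Group (CommutativeRing.+-group ℤmod) public using ()
    renaming (∙-cancelʳ to +-cancelʳ)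

  _≈?_ : ∀ x y → Dec (x ≈ y)
  x ≈? y = Dec.map′ fromMod toMod (d ℕ.∣? ∣ x - y ∣)

  ^-congˡ : ∀ n {x y} → x ≈ y → x ^ n ≈ y ^ n
  ^-congˡ zero    x≈y = ≈-refl
  ^-congˡ (suc n) x≈y = *-cong x≈y (^-congˡ n x≈y)

  ^*≈1 : ∀ {x} n j → x ^ n ≈ 1ℤ → x ^ (n ℕ.* j) ≈ 1ℤ
  ^*≈1 {x} n j x^n≈1 = begin
    x ^ (n ℕ.* j)  ≡⟨ sym (ℤ.^-*-assoc x n j) ⟩
    (x ^ n) ^ j    ≈⟨ ^-congˡ j x^n≈1 ⟩
    1ℤ ^ j         ≡⟨ ℤ.^-zeroˡ j ⟩
    1ℤ             ∎
    where open ≈-Reasoning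

  ^-periodic : ∀ {x} n i j → x ^ n ≈ 1ℤ → x ^ (i ℕ.+ n ℕ.* j) ≈ x ^ i
  ^-periodic {x} n i j x^n≈1 = begin
    x ^ (i ℕ.+ n ℕ.* j)     ≡⟨ ℤ.^-distribˡ-+-* x i (n ℕ.* j) ⟩
    x ^ i * x ^ (n ℕ.* j)   ≈⟨ *-cong (≈-refl {x ^ i}) (^*≈1 n j x^n≈1) ⟩
    x ^ i * 1ℤ              ≡⟨ ℤ.*-identityʳ (x ^ i) ⟩
    x ^ i                   ∎
    where open ≈-Reasoning

  sumTo-cong : ∀ n {f h : ℕ → ℤ} → (∀ k → f k ≈ h k) → sumTo n f ≈ sumTo n h
  sumTo-cong zero    f≈h = ≈-refl
  sumTo-cong (suc n) f≈h = +-cong (sumTo-cong n f≈h) (f≈h (suc n))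

  sumTo-count : ∀ {P : ℕ → Set} (P? : Decidable P) n {f} c →
    (∀ k → P k → f k ≈ c) → (∀ k → ¬ P k → f k ≈ 0ℤ) → sumTo n f ≈ + count P? n * c
  sumTo-count P? zero    c yes≈c no≈0 = ≡⇒≈ (sym (ℤ.*-zeroˡ c))
  sumTo-count P? (suc n) {f} c yes≈c no≈0 with P? (suc n)
  ... | yes Pn = begin
    sumTo n f + f (suc n)        ≈⟨ +-cong (sumTo-count P? n c yes≈c no≈0) (yes≈c (suc n) Pn) ⟩
    + count P? n * c + c         ≡⟨ ℤ.+-comm (+ count P? n * c) c ⟩
    c + + count P? n * c         ≡⟨ sym (ℤ.suc-* (+ count P? n) c) ⟩
    + suc (count P? n) * c       ∎
    where open ≈-Reasoning
  ... | no ¬Pn = begin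
    sumTo n f + f (suc n)        ≈⟨ +-cong (sumTo-count P? n c yes≈c no≈0) (no≈0 (suc n) ¬Pn) ⟩
    + count P? n * c + 0ℤ        ≡⟨ ℤ.+-identityʳ (+ count P? n * c) ⟩
    + count P? n * c             ∎
    where open ≈-Reasoning

  sumTo-rotate≈ : ∀ n f → f (suc n) ≈ f 1 → sumTo n (f ∘ suc) ≈ sumTo n f
  sumTo-rotate≈ n f f[1+n]≈f1 = +-cancelʳ (f 1) (sumTo n (f ∘ suc)) (sumTo n f) (begin
    sumTo n (f ∘ suc) + f 1   ≡⟨ sumTo-rotate n f ⟩
    sumTo n f + f (suc n)     ≈⟨ +-cong (≈-refl {sumTo n f}) f[1+n]≈f1 ⟩
    sumTo n f + f 1           ∎)
    where open ≈-Reasoning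

  x*y≈z⇒y≈z*u : ∀ {x y z u} → x * y ≈ z → x * u ≈ 1ℤ → y ≈ z * u
  x*y≈z⇒y≈z*u {x} {y} {z} {u} x*y≈z x*u≈1 = begin
    y              ≡⟨ ℤ.*-identityʳ y ⟨
    y * 1ℤ         ≈⟨ *-cong (≈-refl {y}) (≈-sym x*u≈1) ⟩
    y * (x * u)    ≡⟨ regroup y x u ⟩
    x * y * u      ≈⟨ *-cong x*y≈z (≈-refl {u}) ⟩
    z * u          ∎
    where
    open ≈-Reasoning
    regroup : ∀ y x u → y * (x * u) ≡ x * y * u
    regroup = solve-∀

  order∣ : ∀ {g n e} → IsMultOrder g d n → g ^ e ≈ 1ℤ → n ℕ.∣ e
  order∣ {g} {n} {e} (0<n , g^n≡1 , minimal) g^e≈1 =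
    ℕ.m%n≡0⇒n∣m e n (below-order (e % n) (ℕ.m%n<n e n) g^r≈1)
    where
    instance _ = ℕ.>-nonZero 0<n
    g^n≈1 : g ^ n ≈ 1ℤ
    g^n≈1 = fromMod g^n≡1
    below-order : ∀ r → r ℕ.< n → g ^ r ≈ 1ℤ → r ≡ 0
    below-order zero    _   _      = refl
    below-order (suc r) r<n g^r≈1 = contradiction (toMod g^r≈1) (minimal (suc r) (s≤s z≤n) r<n)
    g^r≈1 : g ^ (e % n) ≈ 1ℤ
    g^r≈1 = begin
      g ^ (e % n)                     ≈⟨ ≈-sym (^-periodic n (e % n) (e / n) g^n≈1) ⟩
      g ^ (e % n ℕ.+ n ℕ.* (e / n))   ≡⟨ cong (λ t → g ^ (e % n ℕ.+ t)) (ℕ.*-comm n (e / n)) ⟩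
      g ^ (e % n ℕ.+ e / n ℕ.* n)     ≡⟨ cong (g ^_) (sym (ℕ.m≡m%n+[m/n]*n e n)) ⟩
      g ^ e                           ≈⟨ g^e≈1 ⟩
      1ℤ                              ∎
      where open ≈-Reasoning

  order∣⇒^≈1 : ∀ {g n e} → IsMultOrder g d n → n ℕ.∣ e → g ^ e ≈ 1ℤ
  order∣⇒^≈1 {g} {n} (_ , g^n≡1 , _) (ℕ.divides s refl) =
    ≈-trans (≡⇒≈ (cong (g ^_) (ℕ.*-comm s n))) (^*≈1 n s (fromMod g^n≡1))

  sumTo-geometric≈ : ∀ {x} n → x ≈ 1ℤ → sumTo n (x ^_) ≈ + n
  sumTo-geometric≈ {x} n x≈1 = begin
    sumTo n (x ^_)         ≈⟨ sumTo-cong n (λ j → ≈-trans (^-congˡ j x≈1) (≡⇒≈ (ℤ.^-zeroˡ j))) ⟩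
    sumTo n (λ _ → 1ℤ)     ≡⟨ sumTo-const n 1ℤ ⟩
    + n * 1ℤ               ≡⟨ ℤ.*-identityʳ (+ n) ⟩
    + n                    ∎
    where open ≈-Reasoning

module PrimeModulus (m : ℕ) (isPrime : Prime (suc m)) where

  p : ℕ
  p = suc m

  open Congruence p public
  open CommutativeRing ℤmod using (commutativeSemiring; +-monoid; +-rawMonoid)
  open import Algebra.Definitions.RawMonoid +-rawMonoid using (sum) renaming (_×_ to _·_)
  open import Algebra.Properties.Semiring.Exp (CommutativeRing.semiring ℤmod) using ()
    renaming (_^_ to _^ₘ_)
  open import Algebra.Properties.Monoid.Sum +-monoid using (sum-init-last; sum-cong-≋; sum-replicate-zero)
  open import Algebra.Properties.CommutativeSemiring.Binomial commutativeSemiring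
    using (binomialTerm) renaming (theorem to binomialTheorem)
  open import Data.Vec.Functional using (init; last; tail)

  n·x≡+n*x : ∀ n x → n · x ≡ + n * x
  n·x≡+n*x zero    x = sym (ℤ.*-zeroˡ x)
  n·x≡+n*x (suc n) x = trans (cong (λ t → x + t) (n·x≡+n*x n x)) (sym (ℤ.suc-* (+ n) x))

  x^ₘn≡x^n : ∀ x n → x ^ₘ n ≡ x ^ n
  x^ₘn≡x^n x zero    = refl
  x^ₘn≡x^n x (suc n) = cong (x *_) (x^ₘn≡x^n x n)

  ·≈0 : ∀ {c} x → p ℕ.∣ c → c · x ≈ 0ℤ
  ·≈0 {c} x p∣c = begin
    c · x    ≡⟨ n·x≡+n*x c x ⟩
    + c * x  ≈⟨ *-cong (∣⇒≈0 (∣ᵤ⇒∣ {+ p} {+ c} p∣c)) ≈-refl ⟩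
    0ℤ * x   ≡⟨ ℤ.*-zeroˡ x ⟩
    0ℤ       ∎
    where open ≈-Reasoning

  p∣pC[1+k] : ∀ {k} → suc k ℕ.< p → p ℕ.∣ p C suc k
  p∣pC[1+k] {k} 1+k<p with euclidsLemma (suc k) (p C suc k) isPrime
    (subst (p ℕ.∣_) (sym ([1+k]*[1+n]C[1+k]≡[1+n]*nCk m k)) (ℕ.m∣m*n (m C k)))
  ... | inj₁ p∣1+k = contradiction (ℕ.∣⇒≤ p∣1+k) (ℕ.<⇒≱ 1+k<p)
  ... | inj₂ p∣pC[1+k] = p∣pC[1+k]

  *≈0 : ∀ {x y} → x * y ≈ 0ℤ → x ≈ 0ℤ ⊎ y ≈ 0ℤ
  *≈0 {x} {y} xy≈0
    with euclidsLemma ∣ x ∣ ∣ y ∣ isPrime (subst (p ℕ.∣_) (ℤ.abs-* x y) (∣⇒∣ᵤ (≈0⇒∣ xy≈0)))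
  ... | inj₁ p∣x = inj₁ (∣⇒≈0 (∣ᵤ⇒∣ p∣x))
  ... | inj₂ p∣y = inj₂ (∣⇒≈0 (∣ᵤ⇒∣ p∣y))

  module _ (x y : ℤ) where

    private
      t : Fin.Fin (suc p) → ℤ
      t = binomialTerm x y p

    binomial-first : t 0F ≈ y ^ p
    binomial-first = begin
      1 · (1ℤ * y ^ₘ p)   ≡⟨ n·x≡+n*x 1 (1ℤ * y ^ₘ p) ⟩
      1ℤ * (1ℤ * y ^ₘ p)  ≡⟨ ℤ.*-identityˡ (1ℤ * y ^ₘ p) ⟩
      1ℤ * y ^ₘ p         ≡⟨ ℤ.*-identityˡ (y ^ₘ p) ⟩
      y ^ₘ p              ≡⟨ x^ₘn≡x^n y p ⟩
      y ^ p               ∎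
      where open ≈-Reasoning

    binomial-middle : sum (init (tail t)) ≈ 0ℤ
    binomial-middle = ≈-trans (sum-cong-≋ vanishes) (sum-replicate-zero m)
      where
      vanishes : ∀ i → t (Fin.suc (inject₁ i)) ≈ 0ℤ
      vanishes i = ·≈0 _ (p∣pC[1+k] (s≤s (subst (ℕ._< m) (sym (toℕ-inject₁ i)) (toℕ<n i))))

    binomial-last : last (tail t) ≈ x ^ p
    binomial-last = begin
      term (suc (toℕ (fromℕ m)))         ≡⟨ cong (term ∘ suc) (toℕ-fromℕ m) ⟩
      (p C p) · (x ^ₘ p * y ^ₘ (p ∸ p))
        ≡⟨ cong₂ (λ c e → c · (x ^ₘ p * y ^ₘ e)) (nCn≡1 p) (ℕ.n∸n≡0 p) ⟩
      1 · (x ^ₘ p * 1ℤ)                  ≡⟨ n·x≡+n*x 1 (x ^ₘ p * 1ℤ) ⟩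
      1ℤ * (x ^ₘ p * 1ℤ)                 ≡⟨ ℤ.*-identityˡ (x ^ₘ p * 1ℤ) ⟩
      x ^ₘ p * 1ℤ                        ≡⟨ ℤ.*-identityʳ (x ^ₘ p) ⟩
      x ^ₘ p                             ≡⟨ x^ₘn≡x^n x p ⟩
      x ^ p                              ∎
      where
      open ≈-Reasoning
      term : ℕ → ℤ
      term k = (p C k) · (x ^ₘ k * y ^ₘ (p ∸ k))

    freshman : (x + y) ^ p ≈ x ^ p + y ^ p
    freshman = begin
      (x + y) ^ p                                    ≡⟨ sym (x^ₘn≡x^n (x + y) p) ⟩
      (x + y) ^ₘ p                                   ≈⟨ binomialTheorem p x y ⟩
      t 0F + sum (tail t)                            ≈⟨ +-cong binomial-first (sum-init-last (tail t)) ⟩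
      y ^ p + (sum (init (tail t)) + last (tail t))
        ≈⟨ +-cong (≈-refl {y ^ p}) (+-cong binomial-middle binomial-last) ⟩
      y ^ p + (0ℤ + x ^ p)                           ≡⟨ cong (_+_ (y ^ p)) (ℤ.+-identityˡ (x ^ p)) ⟩
      y ^ p + x ^ p                                  ≡⟨ ℤ.+-comm (y ^ p) (x ^ p) ⟩
      x ^ p + y ^ p                                  ∎
      where open ≈-Reasoning

  fermat : ∀ x → x ^ p ≈ x
  fermat (+ zero)  = ≡⇒≈ (ℤ.*-zeroˡ (0ℤ ^ m))
  fermat (+ suc n) = begin
    (1ℤ + + n) ^ p      ≈⟨ freshman 1ℤ (+ n) ⟩
    1ℤ ^ p + (+ n) ^ p  ≈⟨ +-cong (≡⇒≈ (ℤ.^-zeroˡ p)) (fermat (+ n)) ⟩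
    1ℤ + + n            ∎
    where open ≈-Reasoning
  fermat -[1+ n ] = +-cancelʳ 1ℤ (-[1+ n ] ^ p) -[1+ n ] (begin
    -[1+ n ] ^ p + 1ℤ        ≡⟨ cong (_+_ (-[1+ n ] ^ p)) (sym (ℤ.^-zeroˡ p)) ⟩
    -[1+ n ] ^ p + 1ℤ ^ p    ≈⟨ ≈-sym (freshman -[1+ n ] 1ℤ) ⟩
    (-[1+ n ] + 1ℤ) ^ p      ≈⟨ fermat-succ n ⟩
    -[1+ n ] + 1ℤ            ∎)
    where
    open ≈-Reasoning
    fermat-succ : ∀ n → (-[1+ n ] + 1ℤ) ^ p ≈ -[1+ n ] + 1ℤ
    fermat-succ zero    = fermat 0ℤ
    fermat-succ (suc n) = fermat -[1+ n ]

  fermat′ : ∀ {x} → x ≉ 0ℤ → x ^ m ≈ 1ℤ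
  fermat′ {x} x≉0 with *≈0 (∣⇒≈0 (subst (+ p ∣ℤ_) (lemma x (x ^ m)) (≈⇒∣ (fermat x))))
    where
    lemma : ∀ x y → x * y - x ≡ x * (y - 1ℤ)
    lemma = solve-∀
  ... | inj₁ x≈0 = contradiction x≈0 x≉0
  ... | inj₂ x^m-1≈0 = ∣⇒≈ (≈0⇒∣ x^m-1≈0)

  0<m : 0 ℕ.< m
  0<m = ℕ.≤-pred (ℕ.nonTrivial⇒n>1 p ⦃ prime⇒nonTrivial isPrime ⦄)

  +n≉0 : ∀ {n} → 0 ℕ.< n → n ℕ.< p → + n ≉ 0ℤ
  +n≉0 {n} 0<n n<p n≈0 = ℕ.<⇒≱ n<p (ℕ.∣⇒≤ ⦃ ℕ.>-nonZero 0<n ⦄ (∣⇒∣ᵤ (≈0⇒∣ n≈0)))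

  coprime⇒≉0 : ∀ {x} → gcd x (+ p) ≡ 1ℤ → x ≉ 0ℤ
  coprime⇒≉0 {x} gcd≡1 x≈0 = contradiction (ℕ.∣1⇒≡1 p∣1) (ℕ.<⇒≢ (ℕ.s≤s 0<m) ∘ sym)
    where
    p∣1 : p ℕ.∣ 1
    p∣1 = subst (p ℕ.∣_) (cong ∣_∣ gcd≡1) (ℕ.gcd-greatest (∣⇒∣ᵤ (≈0⇒∣ x≈0)) ℕ.∣-refl)

  inverse : ∀ {x} → x ≉ 0ℤ → x * x ^ ℕ.pred m ≈ 1ℤ
  inverse {x} x≉0 = ≈-trans (≡⇒≈ (cong (x ^_) (ℕ.suc-pred m ⦃ ℕ.>-nonZero 0<m ⦄))) (fermat′ x≉0)

  sumTo-geometric≈0 : ∀ {x} n → x ^ n ≈ 1ℤ → x ≉ 1ℤ → sumTo n (x ^_) ≈ 0ℤ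
  sumTo-geometric≈0 {x} n x^n≈1 x≉1 with *≈0 x-1*sum≈0
    where
    x-1*sum≈0 : (x - 1ℤ) * sumTo n (x ^_) ≈ 0ℤ
    x-1*sum≈0 = begin
      (x - 1ℤ) * sumTo n (x ^_) ≡⟨ sumTo-geometric x n ⟩
      x * x ^ n - x             ≈⟨ +-cong (*-cong (≈-refl {x}) x^n≈1) (≈-refl { - x}) ⟩
      x * 1ℤ - x                ≡⟨ cong (_- x) (ℤ.*-identityʳ x) ⟩
      x - x                     ≡⟨ ℤ.+-inverseʳ x ⟩
      0ℤ                        ∎
      where open ≈-Reasoning
  ... | inj₁ x-1≈0 = contradiction (∣⇒≈ (≈0⇒∣ x-1≈0)) x≉1
  ... | inj₂ sum≈0 = sum≈0

  module _ {g : ℤ} (g≉0 : g ≉ 0ℤ) where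

    g^m≈1 : g ^ m ≈ 1ℤ
    g^m≈1 = fermat′ g≉0

    shiftedSum : ℕ → ℤ
    shiftedSum a = sumTo m (λ k → g ^ ((k ℕ.+ a) ℕ.* (k ℕ.+ a)))

    shiftedSum-suc : ∀ a → shiftedSum (suc a) ≈ shiftedSum a
    shiftedSum-suc a = begin
      shiftedSum (suc a)     ≈⟨ sumTo-cong m (λ k → ≡⇒≈ (cong (λ t → g ^ (t ℕ.* t)) (ℕ.+-suc k a))) ⟩
      sumTo m (f ∘ suc)      ≈⟨ sumTo-rotate≈ m f f[1+m]≈f1 ⟩
      shiftedSum a           ∎
      where
      open ≈-Reasoning
      f : ℕ → ℤ
      f k = g ^ ((k ℕ.+ a) ℕ.* (k ℕ.+ a))
      expand : ∀ m a → (suc m ℕ.+ a) ℕ.* (suc m ℕ.+ a) ≡ suc a ℕ.* suc a ℕ.+ m ℕ.* (m ℕ.+ 2 ℕ.* suc a)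
      expand = ℕ.solve-∀
      f[1+m]≈f1 : f (suc m) ≈ f 1
      f[1+m]≈f1 = ≈-trans (≡⇒≈ (cong (g ^_) (expand m a))) (^-periodic m (suc a ℕ.* suc a) _ g^m≈1)

    shiftedSum≈Q : ∀ a → shiftedSum a ≈ Q g 1ℤ p
    shiftedSum≈Q zero    = sumTo-cong m λ k → ≡⇒≈ (begin
      g ^ ((k ℕ.+ 0) ℕ.* (k ℕ.+ 0)) ≡⟨ cong (λ t → g ^ (t ℕ.* t)) (ℕ.+-identityʳ k) ⟩
      g ^ (k ℕ.* k)                 ≡⟨ ℤ.*-identityʳ (g ^ (k ℕ.* k)) ⟨
      g ^ (k ℕ.* k) * 1ℤ            ≡⟨ cong (g ^ (k ℕ.* k) *_) (ℤ.^-zeroˡ k) ⟨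
      g ^ (k ℕ.* k) * 1ℤ ^ k        ∎)
      where open ≡-Reasoning
    shiftedSum≈Q (suc a) = ≈-trans (shiftedSum-suc a) (shiftedSum≈Q a)

    Q[h²]*g^[a*a]≈shiftedSum : ∀ {h} a → h ≈ g ^ a → Q g (h * h) p * g ^ (a ℕ.* a) ≈ shiftedSum a
    Q[h²]*g^[a*a]≈shiftedSum {h} a h≈g^a = begin
      Q g (h * h) p * g ^ (a ℕ.* a)                                  ≡⟨ sumTo-*ʳ m (g ^ (a ℕ.* a)) _ ⟩
      sumTo m (λ k → g ^ (k ℕ.* k) * (h * h) ^ k * g ^ (a ℕ.* a))    ≈⟨ sumTo-cong m term ⟩
      shiftedSum a                                                   ∎
      where
      open ≈-Reasoning
      h*h≈g^[a+a] : h * h ≈ g ^ (a ℕ.+ a)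
      h*h≈g^[a+a] = ≈-trans (*-cong h≈g^a h≈g^a) (≡⇒≈ (sym (ℤ.^-distribˡ-+-* g a a)))
      square : ∀ k a → k ℕ.* k ℕ.+ (a ℕ.+ a) ℕ.* k ℕ.+ a ℕ.* a ≡ (k ℕ.+ a) ℕ.* (k ℕ.+ a)
      square = ℕ.solve-∀
      term : ∀ k → g ^ (k ℕ.* k) * (h * h) ^ k * g ^ (a ℕ.* a) ≈ g ^ ((k ℕ.+ a) ℕ.* (k ℕ.+ a))
      term k = begin
        g ^ (k ℕ.* k) * (h * h) ^ k * g ^ (a ℕ.* a)
          ≈⟨ *-cong (*-cong (≈-refl {g ^ (k ℕ.* k)}) (^-congˡ k h*h≈g^[a+a])) (≈-refl {g ^ (a ℕ.* a)}) ⟩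
        g ^ (k ℕ.* k) * (g ^ (a ℕ.+ a)) ^ k * g ^ (a ℕ.* a)
          ≡⟨ cong (λ t → g ^ (k ℕ.* k) * t * g ^ (a ℕ.* a)) (ℤ.^-*-assoc g (a ℕ.+ a) k) ⟩
        g ^ (k ℕ.* k) * g ^ ((a ℕ.+ a) ℕ.* k) * g ^ (a ℕ.* a)
          ≡⟨ ^-distribˡ-+-+ g (k ℕ.* k) ((a ℕ.+ a) ℕ.* k) (a ℕ.* a) ⟨
        g ^ (k ℕ.* k ℕ.+ (a ℕ.+ a) ℕ.* k ℕ.+ a ℕ.* a)
          ≡⟨ cong (g ^_) (square k a) ⟩
        g ^ ((k ℕ.+ a) ℕ.* (k ℕ.+ a)) ∎

    g⁻¹ : ℤ
    g⁻¹ = g ^ ℕ.pred m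

    g^[k+j]²*g⁻¹^j²≈g^k²*[g^2k]^j : ∀ k j →
      g ^ ((k ℕ.+ j) ℕ.* (k ℕ.+ j)) * g⁻¹ ^ (j ℕ.* j) ≈ g ^ (k ℕ.* k) * (g ^ (2 ℕ.* k)) ^ j
    g^[k+j]²*g⁻¹^j²≈g^k²*[g^2k]^j k j = begin
      g ^ ((k ℕ.+ j) ℕ.* (k ℕ.+ j)) * g⁻¹ ^ (j ℕ.* j)
        ≡⟨ cong (g ^ ((k ℕ.+ j) ℕ.* (k ℕ.+ j)) *_) (ℤ.^-*-assoc g (ℕ.pred m) (j ℕ.* j)) ⟩
      g ^ ((k ℕ.+ j) ℕ.* (k ℕ.+ j)) * g ^ (ℕ.pred m ℕ.* (j ℕ.* j))
        ≡⟨ ℤ.^-distribˡ-+-* g ((k ℕ.+ j) ℕ.* (k ℕ.+ j)) (ℕ.pred m ℕ.* (j ℕ.* j)) ⟨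
      g ^ ((k ℕ.+ j) ℕ.* (k ℕ.+ j) ℕ.+ ℕ.pred m ℕ.* (j ℕ.* j))
        ≡⟨ cong (g ^_) (trans (expand k j (ℕ.pred m)) (cong (λ t → e ℕ.+ t ℕ.* (j ℕ.* j)) suc-pred-m)) ⟩
      g ^ (e ℕ.+ m ℕ.* (j ℕ.* j))
        ≈⟨ ^-periodic m e (j ℕ.* j) g^m≈1 ⟩
      g ^ e
        ≡⟨ ℤ.^-distribˡ-+-* g (k ℕ.* k) ((2 ℕ.* k) ℕ.* j) ⟩
      g ^ (k ℕ.* k) * g ^ ((2 ℕ.* k) ℕ.* j)
        ≡⟨ cong (g ^ (k ℕ.* k) *_) (ℤ.^-*-assoc g (2 ℕ.* k) j) ⟨
      g ^ (k ℕ.* k) * (g ^ (2 ℕ.* k)) ^ j ∎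
      where
      open ≈-Reasoning
      e : ℕ
      e = k ℕ.* k ℕ.+ (2 ℕ.* k) ℕ.* j
      suc-pred-m : suc (ℕ.pred m) ≡ m
      suc-pred-m = ℕ.suc-pred m ⦃ ℕ.>-nonZero 0<m ⦄
      expand : ∀ k j q → (k ℕ.+ j) ℕ.* (k ℕ.+ j) ℕ.+ q ℕ.* (j ℕ.* j)
                       ≡ k ℕ.* k ℕ.+ (2 ℕ.* k) ℕ.* j ℕ.+ suc q ℕ.* (j ℕ.* j)
      expand = ℕ.solve-∀

    conjugateSum : ℤ
    conjugateSum = sumTo m (λ j → g⁻¹ ^ (j ℕ.* j))

    Q*conjugateSum : Q g 1ℤ p * conjugateSum
                   ≈ sumTo m (λ k → g ^ (k ℕ.* k) * sumTo m (λ j → (g ^ (2 ℕ.* k)) ^ j))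
    Q*conjugateSum = begin
      Q g 1ℤ p * sumTo m c
        ≡⟨ sumTo-*ˡ m (Q g 1ℤ p) c ⟩
      sumTo m (λ j → Q g 1ℤ p * c j)
        ≈⟨ sumTo-cong m (λ j → *-cong (≈-sym (shiftedSum≈Q j)) (≈-refl {c j})) ⟩
      sumTo m (λ j → shiftedSum j * c j)
        ≈⟨ sumTo-cong m (λ j → ≡⇒≈ (sumTo-*ʳ m (c j) _)) ⟩
      sumTo m (λ j → sumTo m (λ k → g ^ ((k ℕ.+ j) ℕ.* (k ℕ.+ j)) * c j))
        ≈⟨ sumTo-cong m (λ j → sumTo-cong m (λ k → g^[k+j]²*g⁻¹^j²≈g^k²*[g^2k]^j k j)) ⟩
      sumTo m (λ j → sumTo m (λ k → g ^ (k ℕ.* k) * (g ^ (2 ℕ.* k)) ^ j))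
        ≡⟨ sumTo-comm m m (λ j k → g ^ (k ℕ.* k) * (g ^ (2 ℕ.* k)) ^ j) ⟩
      sumTo m (λ k → sumTo m (λ j → g ^ (k ℕ.* k) * (g ^ (2 ℕ.* k)) ^ j))
        ≈⟨ sumTo-cong m (λ k → ≡⇒≈ (sym (sumTo-*ˡ m (g ^ (k ℕ.* k)) _))) ⟩
      sumTo m (λ k → g ^ (k ℕ.* k) * sumTo m (λ j → (g ^ (2 ℕ.* k)) ^ j)) ∎
      where
      open ≈-Reasoning
      c : ℕ → ℤ
      c j = g⁻¹ ^ (j ℕ.* j)

    Q[h²]*g^[a*a]≈Q : ∀ {h} a → h ≈ g ^ a → Q g (h * h) p * g ^ (a ℕ.* a) ≈ Q g 1ℤ p
    Q[h²]*g^[a*a]≈Q a h≈g^a = ≈-trans (Q[h²]*g^[a*a]≈shiftedSum a h≈g^a) (shiftedSum≈Q a)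

    module _ (squares : ∀ k → g ^ (2 ℕ.* k) ≈ 1ℤ → g ^ (k ℕ.* k) ≈ 1ℤ) where

      private
        P? : Decidable (λ k → g ^ (2 ℕ.* k) ≈ 1ℤ)
        P? k = g ^ (2 ℕ.* k) ≈? 1ℤ

        inner : ℕ → ℤ
        inner k = g ^ (k ℕ.* k) * sumTo m (λ j → (g ^ (2 ℕ.* k)) ^ j)

        inner-yes : ∀ k → g ^ (2 ℕ.* k) ≈ 1ℤ → inner k ≈ + m
        inner-yes k g^2k≈1 = begin
          inner k      ≈⟨ *-cong (squares k g^2k≈1) (sumTo-geometric≈ m g^2k≈1) ⟩
          1ℤ * + m     ≡⟨ ℤ.*-identityˡ (+ m) ⟩
          + m          ∎
          where open ≈-Reasoning

        inner-no : ∀ k → g ^ (2 ℕ.* k) ≉ 1ℤ → inner k ≈ 0ℤ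
        inner-no k g^2k≉1 = begin
          inner k               ≈⟨ *-cong (≈-refl {g ^ (k ℕ.* k)}) (sumTo-geometric≈0 m g^2k^m≈1 g^2k≉1) ⟩
          g ^ (k ℕ.* k) * 0ℤ    ≡⟨ ℤ.*-zeroʳ (g ^ (k ℕ.* k)) ⟩
          0ℤ                    ∎
          where
          open ≈-Reasoning
          g^2k^m≈1 : (g ^ (2 ℕ.* k)) ^ m ≈ 1ℤ
          g^2k^m≈1 =
            ≈-trans (≡⇒≈ (trans (ℤ.^-*-assoc g (2 ℕ.* k) m) (cong (g ^_) (ℕ.*-comm (2 ℕ.* k) m))))
                    (^*≈1 m (2 ℕ.* k) g^m≈1)

        g^2m≈1 : g ^ (2 ℕ.* m) ≈ 1ℤ
        g^2m≈1 = ≈-trans (≡⇒≈ (cong (g ^_) (ℕ.*-comm 2 m))) (^*≈1 m 2 g^m≈1)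

      Q≉0 : Q g 1ℤ p ≉ 0ℤ
      Q≉0 Q≈0 with *≈0 c*m≈0
        where
        c*m≈0 : + count P? m * + m ≈ 0ℤ
        c*m≈0 = begin
          + count P? m * + m                                    ≈⟨ ≈-sym (sumTo-count P? m (+ m) inner-yes inner-no) ⟩
          sumTo m inner                                         ≈⟨ ≈-sym Q*conjugateSum ⟩
          Q g 1ℤ p * conjugateSum                               ≈⟨ *-cong Q≈0 (≈-refl {conjugateSum}) ⟩
          0ℤ * conjugateSum                                     ≡⟨ ℤ.*-zeroˡ conjugateSum ⟩
          0ℤ                                                    ∎
          where open ≈-Reasoning
      ... | inj₁ c≈0 = +n≉0 (count>0 P? 0<m g^2m≈1) (s≤s (count≤ P? m)) c≈0
      ... | inj₂ m≈0 = +n≉0 0<m ℕ.≤-refl m≈0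

      Q[h²]≉0 : ∀ {h} a → h ≈ g ^ a → Q g (h * h) p ≉ 0ℤ
      Q[h²]≉0 {h} a h≈g^a Q[h²]≈0 = Q≉0 (begin
        Q g 1ℤ p                       ≈⟨ ≈-sym (Q[h²]*g^[a*a]≈Q a h≈g^a) ⟩
        Q g (h * h) p * g ^ (a ℕ.* a)  ≈⟨ *-cong Q[h²]≈0 (≈-refl {g ^ (a ℕ.* a)}) ⟩
        0ℤ * g ^ (a ℕ.* a)             ≡⟨ ℤ.*-zeroˡ (g ^ (a ℕ.* a)) ⟩
        0ℤ                             ∎)
        where open ≈-Reasoning

theorem1 : (p : ℕ) → Prime p → (g : ℤ) → gcd g (+ p) ≡ 1ℤ →
    (n : ℕ) → IsMultOrder g p n → n % 4 ≢ 2 →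
    (a : ℕ) → (h : ℤ) → h ≡ (g ^ a) [mod p ] →
    (∃ λ u → (Q g (h * h) p * u) ≡ 1ℤ [mod p ]) ×
    (∀ u → (Q g (h * h) p * u) ≡ 1ℤ [mod p ] →
      (g ^ (a Data.Nat.* a)) ≡ (Q g 1ℤ p * u) [mod p ])
theorem1 zero      isPrime = contradiction (prime⇒nonZero isPrime) λ ()
theorem1 (suc m) isPrime g gcd≡1 n order n%4≢2 a h h≡g^a =
  (Q[h²] ^ ℕ.pred m , toMod (inverse (Q[h²]≉0 g≉0 squares a h≈g^a))) ,
  λ u Q[h²]*u≡1 → toMod (x*y≈z⇒y≈z*u {Q[h²]} {g ^ (a ℕ.* a)} {Q g 1ℤ p} {u}
                            (Q[h²]*g^[a*a]≈Q g≉0 a h≈g^a) (fromMod Q[h²]*u≡1))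
  where
  open PrimeModulus m isPrime
  Q[h²] : ℤ
  Q[h²] = Q g (h * h) p
  h≈g^a : h ≈ g ^ a
  h≈g^a = fromMod h≡g^a
  g≉0 : g ≉ 0ℤ
  g≉0 = coprime⇒≉0 gcd≡1
  squares : ∀ k → g ^ (2 ℕ.* k) ≈ 1ℤ → g ^ (k ℕ.* k) ≈ 1ℤ
  squares k g^2k≈1 = order∣⇒^≈1 order (∣2k⇒∣k*k n k n%4≢2 (order∣ order g^2k≈1))
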